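{- Let $n \in \mathbb{N}$ and let $x,y \in \{0,1\}^n$ with ${\sf dist}(x,y) = 1$. Let $C_x = \{c_k, c_{k+1},\dots,c_{n-k}\}$ and $C_y = \{c'_{k'}, c'_{k'+1},\dots,c'_{n-k'}\}$ be the chains of the BTK partition containing $x$ and $y$ respectively, where $c_i$ and $c'_i$ have Hamming weight $i$. Then ${\sf dist}({\sf signature}(x),{\sf signature}(y)) \le 3$. In particular: (1) $|k-k'| \le 1$; (2) for every $j \in [k,n-k]$ and $j' \in [k',n-k']$, ${\sf dist}(c_j, c'_{j'}) \le |j-j'| + 6$.
   Context: ${\sf dist}$ denotes Hamming distance (number of coordinates in which two strings of equal length differ). BTK partition: given $x \in \{0,1\}^n$, repeatedly find among the currently unmarked coordinates two that are consecutive (ignoring marked coordinates) with values $1$ then $0$, and mark both; stop when the unmarked coordinates, read left to right, form a string $0\cdots01\cdots1$. (Equivalently, viewing $1$ as an opening and $0$ as a closing parenthesis, mark all maximal matched parenthesis subsequences; the resulting set of marked coordinates does not depend on the order of choices.) The signature ${\sf signature}(x) \in \{0,1,\sqcup\}^n$ has $i$-th entry $x_i$ if coordinate $i$ is marked and $\sqcup$ otherwise. The chain $C_x$ is the set of all $y \in \{0,1\}^n$ with ${\sf signature}(y) = {\sf signature}(x)$; i.e. strings agreeing with $x$ on its marked coordinates and of the form $0\cdots01\cdots1$ on the unmarked ones. If $x$ has $2k$ marked coordinates, $C_x = \{c_k,\dots,c_{n-k}\}$ with $c_i$ of weight $i$, forming a symmetric chain. -}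

module Defs where

open import Data.Bool using (Bool; true; false; _∨_; if_then_else_)
open import Data.Bool.Properties using () renaming (_≟_ to _≟B_)
open import Data.Nat using (ℕ; zero; suc; _+_; ⌊_/2⌋)
open import Data.Vec using (Vec; []; _∷_; zipWith)
open import Data.Maybe using (Maybe; just; nothing)
open import Data.Maybe.Properties using (≡-dec)
open import Data.Product using (_×_; _,_; proj₁)
open import Relation.Nullary using (yes; no)
open import Relation.Binary.PropositionalEquality using (_≡_)
open import Relation.Binary.Definitions using (DecidableEquality)

-- Binary strings of length n: x ∈ {0,1}^n, with true = 1, false = 0.
BitString : ℕ → Set
BitString n = Vec Bool n

hamming : {A : Set} → DecidableEquality A → {n : ℕ} → Vec A n → Vec A n → ℕ
hamming _≟_ [] [] = 0
hamming _≟_ (a ∷ as) (b ∷ bs) with a ≟ b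
... | yes _ = hamming _≟_ as bs
... | no  _ = suc (hamming _≟_ as bs)

dist : {n : ℕ} → BitString n → BitString n → ℕ
dist = hamming _≟B_

weight : {n : ℕ} → BitString n → ℕ
weight [] = 0
weight (true ∷ xs) = suc (weight xs)
weight (false ∷ xs) = weight xs

-- BTK partition, via parenthesis matching (1 = "(", 0 = ")").
-- Marked 0s: scanning left to right with d = number of currently unmatched 1s,
-- a 0 is matched (marked) iff d > 0 (then it closes the most recent open 1).
markedZeros : {n : ℕ} → ℕ → BitString n → Vec Bool n
markedZeros d [] = []
markedZeros d (true ∷ xs) = false ∷ markedZeros (suc d) xs
markedZeros zero (false ∷ xs) = false ∷ markedZeros zero xs
markedZeros (suc d) (false ∷ xs) = true ∷ markedZeros d xs

-- Marked 1s: scanning right to left with c = number of currently unmatched 0s,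
-- a 1 is matched (marked) iff c > 0.  Returns flags and the final count.
markedOnesAux : {n : ℕ} → BitString n → Vec Bool n × ℕ
markedOnesAux [] = [] , 0
markedOnesAux (false ∷ xs) with markedOnesAux xs
... | m , c = false ∷ m , suc c
markedOnesAux (true ∷ xs) with markedOnesAux xs
... | m , zero  = false ∷ m , zero
... | m , suc c = true ∷ m , c

marked : {n : ℕ} → BitString n → Vec Bool n
marked x = zipWith _∨_ (markedZeros 0 x) (proj₁ (markedOnesAux x))

-- Signature in {0,1,⊔}^n: just b = marked coordinate with value b, nothing = ⊔
signature : {n : ℕ} → BitString n → Vec (Maybe Bool) n
signature x = zipWith (λ m b → if m then just b else nothing) (marked x) x

sigDist : {n : ℕ} → Vec (Maybe Bool) n → Vec (Maybe Bool) n → ℕ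
sigDist = hamming (≡-dec _≟B_)

-- Chain membership: y ∈ C_x iff signature y = signature x
_∈Chain_ : {n : ℕ} → BitString n → BitString n → Set
y ∈Chain x = signature y ≡ signature x

countTrue : {n : ℕ} → Vec Bool n → ℕ
countTrue = weight

chainK : {n : ℕ} → BitString n → ℕ
chainK x = ⌊ countTrue (marked x) /2⌋

module Submission where

-- Read 1 as "(" and 0 as ")".  A 0 is marked when a left-to-right scan finds an
-- open 1 closing it; a 1 is marked when a right-to-left scan finds an unmatched
-- 0 after it.  We put the right-to-left scan in closed form (unmatchedZeros,
-- markedOnes) and let the left-to-right scan start with d "phantom" open 1s
-- (marksFrom d).  Two shift lemmas say that k extra phantoms close exactly
-- k ⊓ (unmatched zeros) further 0s.  Then:
--   * marks come in matched pairs, and matched pairs plus unmatched zeros count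
--     all zeros; a flip 1 → 0 adds one zero and 0, 1 or 2 unmatched ones, so k
--     moves by at most one;
--   * along the common prefix of a flip, sigDist + (d ∸ unmatched zeros) is
--     controlled by an invariant, giving sigDist ≤ 3 at depth 0;
--   * any two strings are sorted (0…01…1) off their marks, whence
--     dist c c′ ≤ |weight c - weight c′| + 2·sigDist.

open import Defs
open import Data.Nat using (ℕ; zero; suc; pred; _+_; _∸_; _⊓_; ⌊_/2⌋; _≤_; ∣_-_∣; z≤n; s≤s; s≤s⁻¹)
open import Data.Nat.Properties
open import Data.Nat.Tactic.RingSolver using (solve-∀)
open import Data.Bool using (Bool; true; false; _∨_; if_then_else_; T)
open import Data.Bool.Properties using (T-∨) renaming (_≟_ to _≟B_)
open import Data.Vec using (Vec; []; _∷_; zipWith)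
open import Data.Maybe using (Maybe; just; nothing)
open import Data.Maybe.Properties using (≡-dec)
open import Data.Product using (_×_; _,_; proj₁; proj₂)
open import Data.Sum using (_⊎_; inj₁; inj₂) renaming (map to ⊎-map)
open import Data.Empty using (⊥-elim)
open import Data.Unit using (⊤; tt)
open import Function using (id)
open import Function.Bundles using (Equivalence)
open import Relation.Nullary using (yes; no)
open import Relation.Binary.PropositionalEquality using (_≡_; refl; sym; trans; cong; subst; subst₂)
open import Relation.Binary.Definitions using (DecidableEquality)

hamming-same-head : ∀ {A : Set} (eq : DecidableEquality A) {n} a (as bs : Vec A n) →
  hamming eq (a ∷ as) (a ∷ bs) ≡ hamming eq as bs
hamming-same-head eq a as bs with eq a a
... | yes _ = refl
... | no a≢a = ⊥-elim (a≢a refl)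

hamming-sym : ∀ {A : Set} (eq : DecidableEquality A) {n} (as bs : Vec A n) →
  hamming eq as bs ≡ hamming eq bs as
hamming-sym eq [] [] = refl
hamming-sym eq (a ∷ as) (b ∷ bs) with eq a b | eq b a
... | yes _   | yes _   = hamming-sym eq as bs
... | no _    | no _    = cong suc (hamming-sym eq as bs)
... | yes a≡b | no b≢a  = ⊥-elim (b≢a (sym a≡b))
... | no a≢b  | yes b≡a = ⊥-elim (a≢b (sym b≡a))

hamming-zero : ∀ {A : Set} (eq : DecidableEquality A) {n} (as bs : Vec A n) →
  hamming eq as bs ≡ 0 → as ≡ bs
hamming-zero eq [] [] _ = refl
hamming-zero eq (a ∷ as) (b ∷ bs) h with eq a b | h
... | yes refl | h′ = cong (a ∷_) (hamming-zero eq as bs h′)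

cancelˡ : ∀ {a} w {b} → a + w ≤ w + b → a ≤ b
cancelˡ {a} w {b} h = +-cancelˡ-≤ w a b (subst (_≤ w + b) (+-comm a w) h)

pred∸ : ∀ m n → pred m ∸ n ≡ m ∸ suc n
pred∸ zero    n = 0∸n≡0 n
pred∸ (suc m) n = refl

min1+pred : ∀ c → 1 ⊓ c + pred c ≡ c
min1+pred zero    = refl
min1+pred (suc c) = refl

∣-∣-≤ : ∀ a b o → a ≤ b + o → b ≤ a + o → ∣ a - b ∣ ≤ o
∣-∣-≤ a b o a≤ b≤ with ∣m-n∣≡[m∸n]∨[n∸m] a b
... | inj₁ eq = subst (_≤ o) (sym eq) (m≤n+o⇒m∸n≤o a b a≤)
... | inj₂ eq = subst (_≤ o) (sym eq) (m≤n+o⇒m∸n≤o b a b≤)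

-- The right-to-left scan in closed form.  unmatchedZeros x counts the 0s of x
-- that no 1 of x closes; a 1 is marked iff some 0 to its right is still unmatched.

unmatchedZeros : ∀ {n} → BitString n → ℕ
unmatchedZeros []           = 0
unmatchedZeros (false ∷ xs) = suc (unmatchedZeros xs)
unmatchedZeros (true ∷ xs)  = pred (unmatchedZeros xs)

isPositive : ℕ → Bool
isPositive zero    = false
isPositive (suc _) = true

markedOnes : ∀ {n} → BitString n → Vec Bool n
markedOnes []           = []
markedOnes (false ∷ xs) = false ∷ markedOnes xs
markedOnes (true ∷ xs)  = isPositive (unmatchedZeros xs) ∷ markedOnes xs

markedOnesAux-closed : ∀ {n} (xs : BitString n) → markedOnesAux xs ≡ (markedOnes xs , unmatchedZeros xs)
markedOnesAux-closed [] = refl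
markedOnesAux-closed (false ∷ xs) rewrite markedOnesAux-closed xs = refl
markedOnesAux-closed (true ∷ xs) rewrite markedOnesAux-closed xs with unmatchedZeros xs
... | zero  = refl
... | suc _ = refl

-- The marks when the left-to-right scan starts with d phantom open 1s, and the
-- signature read off a mask; the BTK marks and signature are the case d = 0.

marksFrom : ∀ {n} → ℕ → BitString n → Vec Bool n
marksFrom d x = zipWith _∨_ (markedZeros d x) (markedOnes x)

sigOf : ∀ {n} → Vec Bool n → BitString n → Vec (Maybe Bool) n
sigOf = zipWith (λ m b → if m then just b else nothing)

sigFrom : ∀ {n} → ℕ → BitString n → Vec (Maybe Bool) n
sigFrom d x = sigOf (marksFrom d x) x

marked-closed : ∀ {n} (x : BitString n) → marked x ≡ marksFrom 0 x
marked-closed x = cong (λ p → zipWith _∨_ (markedZeros 0 x) (proj₁ p)) (markedOnesAux-closed x)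

-- The signature entry of a 1 followed by a suffix with c unmatched zeros.
markedOne : ℕ → Maybe Bool
markedOne c = if isPositive c then just true else nothing

signature-closed : ∀ {n} (x : BitString n) → signature x ≡ sigFrom 0 x
signature-closed x = cong (λ m → sigOf m x) (marked-closed x)

-- Starting with p + k instead of p phantom 1s, the extra k
-- phantoms close the next k ⊓ (unmatchedZeros s ∸ p) unmatched zeros; exactly
-- these coordinates become marked, so the signatures differ there and nowhere else.

sigShift : ∀ {n} p k (s : BitString n) →
  sigDist (sigFrom (p + k) s) (sigFrom p s) ≡ k ⊓ (unmatchedZeros s ∸ p)
sigShift p k [] = sym (trans (cong (k ⊓_) (0∸n≡0 p)) (⊓-zeroʳ k))
sigShift p k (true ∷ s) =
  trans (hamming-same-head (≡-dec _≟B_) (markedOne (unmatchedZeros s))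
                             (sigFrom (suc (p + k)) s) (sigFrom (suc p) s))
        (trans (sigShift (suc p) k s) (cong (k ⊓_) (sym (pred∸ (unmatchedZeros s) p))))
sigShift (suc p) k       (false ∷ s) = sigShift p k s
sigShift zero    zero    (false ∷ s) = sigShift zero zero s
sigShift zero    (suc k) (false ∷ s) = cong suc (sigShift zero k s)

markShift : ∀ {n} p k (s : BitString n) →
  weight (marksFrom (p + k) s) ≡ weight (marksFrom p s) + k ⊓ (unmatchedZeros s ∸ p)
markShift p k [] = sym (trans (cong (k ⊓_) (0∸n≡0 p)) (⊓-zeroʳ k))
markShift p k (true ∷ s) =
  same-head (isPositive (unmatchedZeros s))
    (trans (markShift (suc p) k s)
           (cong (λ z → weight (marksFrom (suc p) s) + k ⊓ z) (sym (pred∸ (unmatchedZeros s) p))))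
  where
  same-head : ∀ {n} b {u v : Vec Bool n} {w} → weight u ≡ weight v + w → weight (b ∷ u) ≡ weight (b ∷ v) + w
  same-head true  eq = cong suc eq
  same-head false eq = eq
markShift (suc p) k       (false ∷ s) = cong suc (markShift p k s)
markShift zero    zero    (false ∷ s) = markShift zero zero s
markShift zero    (suc k) (false ∷ s) = trans (cong suc (markShift zero k s)) (sym (+-suc _ _))

-- Matched pairs.  A 1 is matched iff some 0 to its right is unmatched by the 1s
-- after it; the BTK parameter k is the number of matched pairs.

matchedPairs : ∀ {n} → BitString n → ℕ
matchedPairs []           = 0
matchedPairs (false ∷ xs) = matchedPairs xs
matchedPairs (true ∷ xs)  = 1 ⊓ unmatchedZeros xs + matchedPairs xs

zeros : ∀ {n} → BitString n → ℕ
zeros []           = 0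
zeros (false ∷ xs) = suc (zeros xs)
zeros (true ∷ xs)  = zeros xs

-- Every 0 is either matched or unmatched.
pairs+unmatched : ∀ {n} (x : BitString n) → matchedPairs x + unmatchedZeros x ≡ zeros x
pairs+unmatched [] = refl
pairs+unmatched (false ∷ xs) = trans (+-suc _ _) (cong suc (pairs+unmatched xs))
pairs+unmatched (true ∷ xs) = begin
  1 ⊓ c + matchedPairs xs + pred c   ≡⟨ regroup (1 ⊓ c) (matchedPairs xs) (pred c) ⟩
  matchedPairs xs + (1 ⊓ c + pred c) ≡⟨ cong (matchedPairs xs +_) (min1+pred c) ⟩
  matchedPairs xs + c                ≡⟨ pairs+unmatched xs ⟩
  zeros xs                           ∎
  where
  open Relation.Binary.PropositionalEquality.≡-Reasoning
  c = unmatchedZeros xs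
  regroup : ∀ a b e → a + b + e ≡ b + (a + e)
  regroup = solve-∀

-- A marked coordinate belongs to a matched pair, so marks come in pairs.
markCount : ∀ {n} (x : BitString n) → weight (marksFrom 0 x) ≡ matchedPairs x + matchedPairs x
markCount [] = refl
markCount (false ∷ xs) = markCount xs
markCount (true ∷ xs) = begin
  weight (isPositive c ∷ marksFrom 1 xs)            ≡⟨ head-weight c ⟩
  1 ⊓ c + weight (marksFrom 1 xs)                   ≡⟨ cong (1 ⊓ c +_) (markShift 0 1 xs) ⟩
  1 ⊓ c + (weight (marksFrom 0 xs) + 1 ⊓ c)         ≡⟨ cong (λ z → 1 ⊓ c + (z + 1 ⊓ c)) (markCount xs) ⟩
  1 ⊓ c + (matchedPairs xs + matchedPairs xs + 1 ⊓ c) ≡⟨ regroup (1 ⊓ c) (matchedPairs xs) ⟩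
  1 ⊓ c + matchedPairs xs + (1 ⊓ c + matchedPairs xs) ∎
  where
  open Relation.Binary.PropositionalEquality.≡-Reasoning
  c = unmatchedZeros xs
  head-weight : ∀ {n} c {v : Vec Bool n} → weight (isPositive c ∷ v) ≡ 1 ⊓ c + weight v
  head-weight zero    = refl
  head-weight (suc c) = refl
  regroup : ∀ a b → a + (b + b + a) ≡ a + b + (a + b)
  regroup = solve-∀

chainK≡matchedPairs : ∀ {n} (x : BitString n) → chainK x ≡ matchedPairs x
chainK≡matchedPairs x = trans (cong (λ m → ⌊ weight m /2⌋) (marked-closed x))
                              (trans (cong ⌊_/2⌋ (markCount x)) (sym (n≡⌊n+n/2⌋ (matchedPairs x))))

data OneFlip : ∀ {n} → BitString n → BitString n → Set where
  here  : ∀ {n} (s : BitString n) → OneFlip (true ∷ s) (false ∷ s)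
  there : ∀ {n} b {xs ys : BitString n} → OneFlip xs ys → OneFlip (b ∷ xs) (b ∷ ys)

dist≡1⇒flip : ∀ {n} (x y : BitString n) → dist x y ≡ 1 → OneFlip x y ⊎ OneFlip y x
dist≡1⇒flip [] [] ()
dist≡1⇒flip (true ∷ xs) (true ∷ ys) h = ⊎-map (there true) (there true) (dist≡1⇒flip xs ys h)
dist≡1⇒flip (false ∷ xs) (false ∷ ys) h = ⊎-map (there false) (there false) (dist≡1⇒flip xs ys h)
dist≡1⇒flip (true ∷ xs) (false ∷ ys) h with hamming-zero _≟B_ xs ys (suc-injective h)
... | refl = inj₁ (here xs)
dist≡1⇒flip (false ∷ xs) (true ∷ ys) h with hamming-zero _≟B_ xs ys (suc-injective h)
... | refl = inj₂ (here xs)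

zeros-flip : ∀ {n} {x y : BitString n} → OneFlip x y → zeros y ≡ suc (zeros x)
zeros-flip (here s) = refl
zeros-flip (there false f) = cong suc (zeros-flip f)
zeros-flip (there true f) = zeros-flip f

unmatched-flip : ∀ {n} {x y : BitString n} → OneFlip x y →
  unmatchedZeros x ≤ unmatchedZeros y × unmatchedZeros y ≤ 2 + unmatchedZeros x
unmatched-flip (here s) = ≤-trans pred[n]≤n (n≤1+n _) , suc≤2+pred (unmatchedZeros s)
  where
  suc≤2+pred : ∀ c → suc c ≤ 2 + pred c
  suc≤2+pred zero    = s≤s z≤n
  suc≤2+pred (suc c) = ≤-refl
unmatched-flip (there false f) with unmatched-flip f
... | lo , hi = s≤s lo , s≤s hi
unmatched-flip (there true f) with unmatched-flip f
... | lo , hi = pred-mono-≤ lo , ≤-trans (pred-mono-≤ hi) (pred[2+c]≤2+pred _)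
  where
  pred[2+c]≤2+pred : ∀ c → pred (2 + c) ≤ 2 + pred c
  pred[2+c]≤2+pred zero    = s≤s z≤n
  pred[2+c]≤2+pred (suc c) = ≤-refl

offset-by-one : ∀ a b u v → a + u + 1 ≡ b + v → u ≤ v → v ≤ 2 + u → ∣ a - b ∣ ≤ 1
offset-by-one a b u v balance u≤v v≤2+u = ∣-∣-≤ a b 1 a≤b+1 b≤a+1
  where
  open ≤-Reasoning
  swap-last : ∀ a u w → a + u + w ≡ a + w + u
  swap-last = solve-∀
  split-two : ∀ b u → b + (2 + u) ≡ b + 1 + (u + 1)
  split-two = solve-∀
  b≤a+1 : b ≤ a + 1
  b≤a+1 = +-cancelʳ-≤ v b (a + 1) (begin
    b + v          ≡⟨ sym balance ⟩
    a + u + 1      ≡⟨ swap-last a u 1 ⟩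
    a + 1 + u      ≤⟨ +-monoʳ-≤ (a + 1) u≤v ⟩
    a + 1 + v      ∎)
  a≤b+1 : a ≤ b + 1
  a≤b+1 = +-cancelʳ-≤ (u + 1) a (b + 1) (begin
    a + (u + 1)    ≡⟨ sym (+-assoc a u 1) ⟩
    a + u + 1      ≡⟨ balance ⟩
    b + v          ≤⟨ +-monoʳ-≤ b v≤2+u ⟩
    b + (2 + u)    ≡⟨ split-two b u ⟩
    b + 1 + (u + 1) ∎)

-- The BTK parameter k moves by at most one under a flip: the flip adds one 0,
-- which is matched or unmatched, and the unmatched zeros grow by at most two.
chainK-flip : ∀ {n} {x y : BitString n} → OneFlip x y → ∣ chainK x - chainK y ∣ ≤ 1
chainK-flip {x = x} {y} f =
  subst₂ (λ k k′ → ∣ k - k′ ∣ ≤ 1) (sym (chainK≡matchedPairs x)) (sym (chainK≡matchedPairs y))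
    (offset-by-one (matchedPairs x) (matchedPairs y) (unmatchedZeros x) (unmatchedZeros y)
      balance (proj₁ (unmatched-flip f)) (proj₂ (unmatched-flip f)))
  where
  balance : matchedPairs x + unmatchedZeros x + 1 ≡ matchedPairs y + unmatchedZeros y
  balance = begin
    matchedPairs x + unmatchedZeros x + 1 ≡⟨ +-comm _ 1 ⟩
    suc (matchedPairs x + unmatchedZeros x) ≡⟨ cong suc (pairs+unmatched x) ⟩
    suc (zeros x)                         ≡⟨ sym (zeros-flip f) ⟩
    zeros y                               ≡⟨ sym (pairs+unmatched y) ⟩
    matchedPairs y + unmatchedZeros y     ∎
    where open Relation.Binary.PropositionalEquality.≡-Reasoning

-- Arithmetic behind the flip coordinate when d = suc e phantoms are open.
flip-arith : ∀ c e → suc (2 ⊓ (c ∸ e)) + (suc e ∸ pred c) ≤ 3 + (e ∸ c)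
flip-arith zero          e       rewrite 0∸n≡0 e = n≤1+n _
flip-arith (suc zero)    zero    = ≤-refl
flip-arith (suc zero)    (suc e) rewrite 0∸n≡0 e = ≤-refl
flip-arith (suc (suc c)) zero    rewrite 0∸n≡0 c = ≤-refl
flip-arith (suc (suc c)) (suc e) = flip-arith (suc c) e

-- The flip coordinate with no open 1: y leaves it unmarked, and after it the
-- two scans differ by one phantom.
flip-at-top : ∀ {n} c (A B : Vec (Maybe Bool) n) → sigDist A B ≡ 1 ⊓ c →
  sigDist (markedOne c ∷ A) (nothing ∷ B) + (0 ∸ pred c) ≤ 3 + (0 ∸ suc c)
flip-at-top zero    A B eq rewrite eq = z≤n
flip-at-top (suc c) A B eq rewrite eq | 0∸n≡0 c = s≤s (s≤s z≤n)

-- The flip coordinate under an open 1: y marks it as a matched 0, and after it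
-- the scans differ by two phantoms.
flip-deep : ∀ {n} e c (A B : Vec (Maybe Bool) n) → sigDist A B ≡ 2 ⊓ (c ∸ e) →
  sigDist (markedOne c ∷ A) (just false ∷ B) + (suc e ∸ pred c) ≤ 3 + (suc e ∸ suc c)
flip-deep e c A B eq =
  subst (λ t → t + (suc e ∸ pred c) ≤ 3 + (e ∸ c)) (sym (trans (head-differs c) (cong suc eq))) (flip-arith c e)
  where
  head-differs : ∀ c → sigDist (markedOne c ∷ A) (just false ∷ B) ≡ suc (sigDist A B)
  head-differs zero    = refl
  head-differs (suc c) = refl

-- A shared 1 in the prefix: its marks agree unless exactly one side still has
-- unmatched zeros after it, which the extra open 1 on that side pays for.
shared-one : ∀ {n} d cx cy (A B : Vec (Maybe Bool) n) → cx ≤ cy →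
  sigDist A B + (suc d ∸ cx) ≤ 3 + (suc d ∸ cy) →
  sigDist (markedOne cx ∷ A) (markedOne cy ∷ B) + (d ∸ pred cx) ≤ 3 + (d ∸ pred cy)
shared-one d zero     zero     A B _  h = s≤s⁻¹ (subst (_≤ 3 + suc d) (+-suc (sigDist A B) d) h)
shared-one d zero     (suc cy) A B _  h = subst (_≤ 3 + (d ∸ cy)) (+-suc (sigDist A B) d) h
shared-one d (suc cx) (suc cy) A B _  h = h

-- The invariant along the common prefix: with d open 1s before the suffixes
-- x, y (y = x with one 1 turned into 0), the signatures from depth d satisfy
-- sigDist + (d ∸ unmatchedZeros x) ≤ 3 + (d ∸ unmatchedZeros y).
flip-signature : ∀ {n} {x y : BitString n} → OneFlip x y → ∀ d →
  sigDist (sigFrom d x) (sigFrom d y) + (d ∸ unmatchedZeros x) ≤ 3 + (d ∸ unmatchedZeros y)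
flip-signature (here s) zero = flip-at-top (unmatchedZeros s) _ _ (sigShift 0 1 s)
flip-signature (here s) (suc e) =
  flip-deep e (unmatchedZeros s) _ _
    (subst (λ q → sigDist (sigFrom q s) (sigFrom e s) ≡ 2 ⊓ (unmatchedZeros s ∸ e)) (+-comm e 2) (sigShift e 2 s))
flip-signature (there false {xs} {ys} f) zero =
  subst₂ (λ a b → sigDist (sigFrom 0 xs) (sigFrom 0 ys) + a ≤ 3 + b) (0∸n≡0 (unmatchedZeros xs)) (0∸n≡0 (unmatchedZeros ys))
    (flip-signature f zero)
flip-signature (there false f) (suc e) = flip-signature f e
flip-signature (there true {xs} {ys} f) d =
  shared-one d (unmatchedZeros xs) (unmatchedZeros ys) _ _ (proj₁ (unmatched-flip f)) (flip-signature f (suc d))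

sigDist-flip : ∀ {n} {x y : BitString n} → OneFlip x y → sigDist (signature x) (signature y) ≤ 3
sigDist-flip {x = x} {y} f =
  subst₂ (λ a b → sigDist a b ≤ 3) (sym (signature-closed x)) (sym (signature-closed y))
    (≤-trans (m≤m+n S (0 ∸ unmatchedZeros x))
             (subst (λ b → S + (0 ∸ unmatchedZeros x) ≤ 3 + b) (0∸n≡0 (unmatchedZeros y)) (flip-signature f 0)))
  where
  S : ℕ
  S = sigDist (sigFrom 0 x) (sigFrom 0 y)

-- SortedOff p m c: reading c on the coordinates where the mask m is false
-- gives 0…01…1; the phase p records that such a 1 was already read before c,
-- so that only 1s may follow.
SortedOff : ∀ {n} → Bool → Vec Bool n → BitString n → Set
SortedOff p []          []      = ⊤
SortedOff p (true ∷ m)  (_ ∷ c) = SortedOff p m c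
SortedOff p (false ∷ m) (b ∷ c) = (T p → T b) × SortedOff (p ∨ b) m c

-- The unmarked coordinates of a BTK scan are sorted: an unmarked 1 has no
-- unmatched 0 after it, and an unmarked 0 occurs only when no 1 is open.
-- (Starting from depth d, once a 1 was read the suffix may have at most d
-- unmatched zeros, all closed by phantoms.)
unmarked-sorted : ∀ {n} d p (c : BitString n) → (T p → unmatchedZeros c ≤ d) → SortedOff p (marksFrom d c) c
unmarked-sorted d p [] _ = tt
unmarked-sorted d p (true ∷ s) h with unmatchedZeros s in eq
... | zero  = (λ _ → tt) , unmarked-sorted (suc d) (p ∨ true) s (λ _ → subst (_≤ suc d) (sym eq) z≤n)
... | suc u = unmarked-sorted (suc d) p s (λ t → subst (_≤ suc d) (sym eq) (s≤s (h t)))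
unmarked-sorted zero    false (false ∷ s) _ = (λ ()) , unmarked-sorted zero false s (λ ())
unmarked-sorted zero    true  (false ∷ s) h with h tt
... | ()
unmarked-sorted (suc d) p     (false ∷ s) h = unmarked-sorted d p s (λ t → s≤s⁻¹ (h t))

-- The invariant for two strings sorted off their masks, with D = distance,
-- W, W′ = weights and S = signature distance: in general D ≤ |W - W′| + 2S, and
-- when c (resp. c′) is already in its block of 1s the larger weight is known.
record Bound (p p′ : Bool) (D W W′ S : ℕ) : Set where
  field
    left    : T p  → D + W′ ≤ W + (S + S)
    right   : T p′ → D + W ≤ W′ + (S + S)
    oneSide : D + W′ ≤ W + (S + S) ⊎ D + W ≤ W′ + (S + S)
open Bound

bit : Bool → ℕ
bit false = 0
bit true  = 1

bound-[] : ∀ {p p′} → Bound p p′ 0 0 0 0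
bound-[] = record { left = λ _ → z≤n ; right = λ _ → z≤n ; oneSide = inj₁ z≤n }

bound-weaken : ∀ {p p′ q q′ D W W′ S} → (T p → T q) → (T p′ → T q′) →
  Bound q q′ D W W′ S → Bound p p′ D W W′ S
bound-weaken tp tp′ b = record { left = λ t → left b (tp t) ; right = λ t → right b (tp′ t) ; oneSide = oneSide b }

bound-step : ∀ {p p′ D W W′ S} δ ω ω′ σ → δ + ω′ ≤ ω + (σ + σ) → δ + ω ≤ ω′ + (σ + σ) →
  Bound p p′ D W W′ S → Bound p p′ (δ + D) (ω + W) (ω′ + W′) (σ + S)
bound-step {D = D} {W} {W′} {S} δ ω ω′ σ e e′ bd = record
  { left    = λ t → add ω′ ω W′ W e (left bd t)
  ; right   = λ t → add ω ω′ W W′ e′ (right bd t)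
  ; oneSide = ⊎-map (add ω′ ω W′ W e) (add ω ω′ W W′ e′) (oneSide bd)
  }
  where
  add : ∀ a b u v → δ + a ≤ b + (σ + σ) → D + u ≤ v + (S + S) → δ + D + (a + u) ≤ b + v + ((σ + S) + (σ + S))
  add a b u v e h = subst₂ _≤_ (interchange δ a D u) (sym (interchange′ b σ v S)) (+-mono-≤ e h)
    where
    interchange : ∀ x y z w → x + y + (z + w) ≡ x + z + (y + w)
    interchange = solve-∀
    interchange′ : ∀ x s y t → x + y + ((s + t) + (s + t)) ≡ x + (s + s) + (y + (t + t))
    interchange′ = solve-∀

bound-agree : ∀ {p p′ D W W′ S} b → Bound p p′ D W W′ S → Bound p p′ D (bit b + W) (bit b + W′) S
bound-agree b = bound-step 0 (bit b) (bit b) 0 (≤-reflexive (sym (+-identityʳ (bit b))))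
                                               (≤-reflexive (sym (+-identityʳ (bit b))))

bound-disagree : ∀ {p p′ D W W′ S} a b b′ → Bound p p′ D W W′ S →
  Bound p p′ (bit a + D) (bit b + W) (bit b′ + W′) (1 + S)
bound-disagree a b b′ = bound-step (bit a) (bit b) (bit b′) 1 (two a b′ b) (two a b b′)
  where
  bit≤1 : ∀ b → bit b ≤ 1
  bit≤1 false = z≤n
  bit≤1 true  = ≤-refl
  two : ∀ a b c → bit a + bit b ≤ bit c + 2
  two a b c = ≤-trans (+-mono-≤ (bit≤1 a) (bit≤1 b)) (m≤n+m 2 (bit c))

-- Both unmarked with c reading 1 and c′ reading 0: c has entered its 1s, which
-- is exactly when its side of the bound is already known for the suffix.
bound-gainLeft : ∀ {p D W W′ S} → D + W′ ≤ W + (S + S) → Bound p false (suc D) (suc W) W′ S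
bound-gainLeft h = record { left = λ _ → s≤s h ; right = λ () ; oneSide = inj₁ (s≤s h) }

bound-gainRight : ∀ {p′ D W W′ S} → D + W ≤ W′ + (S + S) → Bound false p′ (suc D) W (suc W′) S
bound-gainRight h = record { left = λ () ; right = λ _ → s≤s h ; oneSide = inj₂ (s≤s h) }

T-∨ˡ : ∀ {a b} → T a → T (a ∨ b)
T-∨ˡ t = Equivalence.from T-∨ (inj₁ t)

T-∨ʳ : ∀ {a b} → T b → T (a ∨ b)
T-∨ʳ t = Equivalence.from T-∨ (inj₂ t)

sorted-bound : ∀ {n} p p′ (m c m′ c′ : Vec Bool n) → SortedOff p m c → SortedOff p′ m′ c′ →
  Bound p p′ (dist c c′) (weight c) (weight c′) (sigDist (sigOf m c) (sigOf m′ c′))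
sorted-bound p p′ [] [] [] [] _ _ = bound-[]
-- both marked: the signatures record the two values
sorted-bound p p′ (true ∷ m) (false ∷ c) (true ∷ m′) (false ∷ c′) s s′ =
  bound-agree false (sorted-bound p p′ m c m′ c′ s s′)
sorted-bound p p′ (true ∷ m) (true ∷ c) (true ∷ m′) (true ∷ c′) s s′ =
  bound-agree true (sorted-bound p p′ m c m′ c′ s s′)
sorted-bound p p′ (true ∷ m) (false ∷ c) (true ∷ m′) (true ∷ c′) s s′ =
  bound-disagree true false true (sorted-bound p p′ m c m′ c′ s s′)
sorted-bound p p′ (true ∷ m) (true ∷ c) (true ∷ m′) (false ∷ c′) s s′ =
  bound-disagree true true false (sorted-bound p p′ m c m′ c′ s s′)
-- exactly one side marked: the signatures differ
sorted-bound p p′ (true ∷ m) (false ∷ c) (false ∷ m′) (false ∷ c′) s (_ , s′) =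
  bound-disagree false false false (bound-weaken id T-∨ˡ (sorted-bound p (p′ ∨ false) m c m′ c′ s s′))
sorted-bound p p′ (true ∷ m) (false ∷ c) (false ∷ m′) (true ∷ c′) s (_ , s′) =
  bound-disagree true false true (bound-weaken id T-∨ˡ (sorted-bound p (p′ ∨ true) m c m′ c′ s s′))
sorted-bound p p′ (true ∷ m) (true ∷ c) (false ∷ m′) (false ∷ c′) s (_ , s′) =
  bound-disagree true true false (bound-weaken id T-∨ˡ (sorted-bound p (p′ ∨ false) m c m′ c′ s s′))
sorted-bound p p′ (true ∷ m) (true ∷ c) (false ∷ m′) (true ∷ c′) s (_ , s′) =
  bound-disagree false true true (bound-weaken id T-∨ˡ (sorted-bound p (p′ ∨ true) m c m′ c′ s s′))
sorted-bound p p′ (false ∷ m) (false ∷ c) (true ∷ m′) (false ∷ c′) (_ , s) s′ =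
  bound-disagree false false false (bound-weaken T-∨ˡ id (sorted-bound (p ∨ false) p′ m c m′ c′ s s′))
sorted-bound p p′ (false ∷ m) (false ∷ c) (true ∷ m′) (true ∷ c′) (_ , s) s′ =
  bound-disagree true false true (bound-weaken T-∨ˡ id (sorted-bound (p ∨ false) p′ m c m′ c′ s s′))
sorted-bound p p′ (false ∷ m) (true ∷ c) (true ∷ m′) (false ∷ c′) (_ , s) s′ =
  bound-disagree true true false (bound-weaken T-∨ˡ id (sorted-bound (p ∨ true) p′ m c m′ c′ s s′))
sorted-bound p p′ (false ∷ m) (true ∷ c) (true ∷ m′) (true ∷ c′) (_ , s) s′ =
  bound-disagree false true true (bound-weaken T-∨ˡ id (sorted-bound (p ∨ true) p′ m c m′ c′ s s′))
-- both unmarked: equal values agree; unequal values put one string into its 1s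
sorted-bound p p′ (false ∷ m) (false ∷ c) (false ∷ m′) (false ∷ c′) (_ , s) (_ , s′) =
  bound-agree false (bound-weaken T-∨ˡ T-∨ˡ (sorted-bound (p ∨ false) (p′ ∨ false) m c m′ c′ s s′))
sorted-bound p p′ (false ∷ m) (true ∷ c) (false ∷ m′) (true ∷ c′) (_ , s) (_ , s′) =
  bound-agree true (bound-weaken T-∨ˡ T-∨ˡ (sorted-bound (p ∨ true) (p′ ∨ true) m c m′ c′ s s′))
sorted-bound p false (false ∷ m) (true ∷ c) (false ∷ m′) (false ∷ c′) (_ , s) (_ , s′) =
  bound-gainLeft (left (sorted-bound (p ∨ true) false m c m′ c′ s s′) (T-∨ʳ tt))
sorted-bound false p′ (false ∷ m) (false ∷ c) (false ∷ m′) (true ∷ c′) (_ , s) (_ , s′) =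
  bound-gainRight (right (sorted-bound false (p′ ∨ true) m c m′ c′ s s′) (T-∨ʳ tt))
sorted-bound p true (false ∷ m) (true ∷ c) (false ∷ m′) (false ∷ c′) _ (h′ , _) = ⊥-elim (h′ tt)
sorted-bound true p′ (false ∷ m) (false ∷ c) (false ∷ m′) (true ∷ c′) (h , _) _ = ⊥-elim (h tt)

bound-dist : ∀ {p p′ D W W′ S} → Bound p p′ D W W′ S → D ≤ ∣ W - W′ ∣ + (S + S)
bound-dist {D = D} {W} {W′} {S} b with oneSide b
... | inj₁ h = cancelˡ W′ (begin
  D + W′                       ≤⟨ h ⟩
  W + (S + S)                  ≤⟨ +-monoˡ-≤ (S + S) (m≤n+∣m-n∣ W W′) ⟩
  W′ + ∣ W - W′ ∣ + (S + S)    ≡⟨ +-assoc W′ ∣ W - W′ ∣ (S + S) ⟩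
  W′ + (∣ W - W′ ∣ + (S + S))  ∎)
  where open ≤-Reasoning
... | inj₂ h = cancelˡ W (begin
  D + W                        ≤⟨ h ⟩
  W′ + (S + S)                 ≤⟨ +-monoˡ-≤ (S + S) (m≤n+∣n-m∣ W′ W) ⟩
  W + ∣ W - W′ ∣ + (S + S)     ≡⟨ +-assoc W ∣ W - W′ ∣ (S + S) ⟩
  W + (∣ W - W′ ∣ + (S + S))   ∎)
  where open ≤-Reasoning

marked-sorted : ∀ {n} (x : BitString n) → SortedOff false (marked x) x
marked-sorted x = subst (λ m → SortedOff false m x) (sym (marked-closed x)) (unmarked-sorted 0 false x (λ ()))

chain-distance : ∀ {n} (c c′ : BitString n) →
  dist c c′ ≤ ∣ weight c - weight c′ ∣ + (sigDist (signature c) (signature c′) + sigDist (signature c) (signature c′))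
chain-distance c c′ =
  bound-dist (sorted-bound false false (marked c) c (marked c′) c′ (marked-sorted c) (marked-sorted c′))

lemma6 : (n : ℕ) (x y : BitString n) → dist x y ≡ 1 →
    (sigDist (signature x) (signature y) ≤ 3)
    × (∣ chainK x - chainK y ∣ ≤ 1)
    × ((c c′ : BitString n) → c ∈Chain x → c′ ∈Chain y →
        dist c c′ ≤ ∣ weight c - weight c′ ∣ + 6)
lemma6 n x y d≡1 = sig≤3 , chainK-close , chains-close
  where
  sig≤3 : sigDist (signature x) (signature y) ≤ 3
  sig≤3 with dist≡1⇒flip x y d≡1
  ... | inj₁ f = sigDist-flip f
  ... | inj₂ f = subst (_≤ 3) (hamming-sym (≡-dec _≟B_) (signature y) (signature x)) (sigDist-flip f)

  chainK-close : ∣ chainK x - chainK y ∣ ≤ 1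
  chainK-close with dist≡1⇒flip x y d≡1
  ... | inj₁ f = chainK-flip f
  ... | inj₂ f = subst (_≤ 1) (∣-∣-comm (chainK y) (chainK x)) (chainK-flip f)

  chains-close : (c c′ : BitString n) → c ∈Chain x → c′ ∈Chain y → dist c c′ ≤ ∣ weight c - weight c′ ∣ + 6
  chains-close c c′ c∈x c′∈y = ≤-trans (chain-distance c c′) (+-monoʳ-≤ ∣ weight c - weight c′ ∣ twice≤6)
    where
    twice≤6 : sigDist (signature c) (signature c′) + sigDist (signature c) (signature c′) ≤ 6
    twice≤6 rewrite c∈x | c′∈y = +-mono-≤ sig≤3 sig≤3
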